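{- Let $p$ be a prime and $F\colon\mathbb F_p^n\to\mathbb F_p^m$ a function. Then for each $\beta\in\mathbb F_p^m$, $$p^{n-m}-\sqrt{\left(1-\tfrac{1}{p^m}\right)\mathcal N_F}\le |F^{ -1}(\beta)|\le p^{n-m}+\sqrt{\left(1-\tfrac{1}{p^m}\right)\mathcal N_F}.$$ Moreover, if some $\beta\in\mathbb F_p^m$ satisfies one of these inequalities with equality, then $|F^{ -1}(\alpha)|=\frac{p^n-|F^{ -1}(\beta)|}{p^m-1}$ for all $\alpha\in\mathbb F_p^m\setminus\{\beta\}$.
   Context: $F^{ -1}(\beta)=\{x\in\mathbb F_p^n: F(x)=\beta\}$. With the standard scalar product $\langle x,y\rangle=\sum_i x_iy_i$ and $\zeta_p=e^{2\pi i/p}$, the Walsh transform is $W_F(b,a)=\sum_{x\in\mathbb F_p^n}\zeta_p^{\langle b,F(x)\rangle-\langle a,x\rangle}$, and the imbalance is $\mathcal N_F=\frac{1}{p^m}\sum_{b\in\mathbb F_p^m\setminus\{0\}}|W_F(b,0)|^2$. -}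

module Defs where

open import Data.Nat as ℕ using (ℕ; zero; suc; NonZero)
open import Data.Nat.Properties using (m^n≢0)
open import Data.Nat.DivMod using (_mod_)
open import Data.Fin as Fin using (Fin; toℕ)
open import Data.Vec as Vec using (Vec; []; _∷_)
open import Data.Vec.Properties using (≡-dec)
open import Data.List as List using (List; []; _∷_; concatMap; map; filter; length; allFin)
open import Data.Integer as ℤ using (ℤ; +_)
open import Data.Rational as ℚ using (ℚ; 0ℚ; 1ℚ; _+_; _*_; _-_)
open import Data.Product using (∃; Σ)
open import Relation.Binary.PropositionalEquality using (_≡_)
open import Relation.Nullary using (yes; no; ¬_)
open import Relation.Nullary.Decidable using (⌊_⌋)

𝔽 : ℕ → ℕ → Set
𝔽 p n = Vec (Fin p) n

allVecs : (p n : ℕ) → List (𝔽 p n)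
allVecs p zero    = [] ∷ []
allVecs p (suc n) = concatMap (λ a → map (a ∷_) (allVecs p n)) (allFin p)

_≟v_ : ∀ {p n} → (x y : 𝔽 p n) → Relation.Nullary.Dec (x ≡ y)
_≟v_ = ≡-dec Fin._≟_

preimageSize : ∀ {p n m} → (𝔽 p n → 𝔽 p m) → 𝔽 p m → ℕ
preimageSize {p} {n} F β = length (filter (λ x → F x ≟v β) (allVecs p n))

dotℕ : ∀ {p n} → 𝔽 p n → 𝔽 p n → ℕ
dotℕ []       []       = 0
dotℕ (a ∷ x) (b ∷ y) = toℕ a ℕ.* toℕ b ℕ.+ dotℕ x y

⟨_,_⟩ : ∀ {p n} .{{_ : NonZero p}} → 𝔽 p n → 𝔽 p n → Fin p
⟨_,_⟩ {p} x y = dotℕ x y mod p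

_⊖_ : ∀ {p} .{{_ : NonZero p}} → Fin p → Fin p → Fin p
_⊖_ {p} i j = (toℕ i ℕ.+ (p ℕ.∸ toℕ j)) mod p

-- The cyclotomic field ℚ(ζ_p), ζ_p = e^{2πi/p}.
-- An element Σ_k c_k ζ^k is represented by its coefficient function
-- c : Fin p → ℚ (i.e. an element of ℚ[x]/(x^p - 1)); since the minimal
-- polynomial of ζ_p (p prime) is 1 + x + ... + x^{p-1}, two coefficient
-- functions denote the same complex number iff their difference is a
-- constant function.
Cyc : ℕ → Set
Cyc p = Fin p → ℚ

_≈ᶜ_ : ∀ {p} → Cyc p → Cyc p → Set
_≈ᶜ_ {p} a b = ∃ λ (c : ℚ) → ∀ (j : Fin p) → a j - b j ≡ c

0ᶜ : ∀ {p} → Cyc p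
0ᶜ _ = 0ℚ

ζ^ : ∀ {p} → Fin p → Cyc p
ζ^ k j = if ⌊ j Fin.≟ k ⌋ then 1ℚ else 0ℚ
  where open import Data.Bool using (if_then_else_)

embed : ∀ {p} .{{_ : NonZero p}} → ℚ → Cyc p
embed {p} q j = q * ζ^ (0 mod p) j

_+ᶜ_ : ∀ {p} → Cyc p → Cyc p → Cyc p
(a +ᶜ b) j = a j + b j

scaleᶜ : ∀ {p} → ℚ → Cyc p → Cyc p
scaleᶜ q a j = q * a j

sumℚ : List ℚ → ℚ
sumℚ = List.foldr _+_ 0ℚ

sumᶜ : ∀ {p} → List (Cyc p) → Cyc p
sumᶜ = List.foldr _+ᶜ_ 0ᶜ

-- multiplication (convolution, using ζ^p = 1)
_*ᶜ_ : ∀ {p} .{{_ : NonZero p}} → Cyc p → Cyc p → Cyc p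
_*ᶜ_ {p} a b j = sumℚ (map (λ i → a i * b (j ⊖ i)) (allFin p))

-- complex conjugation: ζ^k ↦ ζ^{-k}
conjᶜ : ∀ {p} .{{_ : NonZero p}} → Cyc p → Cyc p
conjᶜ {p} a j = a ((0 mod p) ⊖ j)

absSqᶜ : ∀ {p} .{{_ : NonZero p}} → Cyc p → Cyc p
absSqᶜ a = a *ᶜ conjᶜ a

walsh : ∀ {p n m} .{{_ : NonZero p}} → (𝔽 p n → 𝔽 p m) → 𝔽 p m → 𝔽 p n → Cyc p
walsh {p} {n} F b a = sumᶜ (map (λ x → ζ^ (⟨ b , F x ⟩ ⊖ ⟨ a , x ⟩)) (allVecs p n))

zeroVec : ∀ {p n} .{{_ : NonZero p}} → 𝔽 p n
zeroVec {p} {n} = Vec.replicate n (0 mod p)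

pow : ℕ → ℕ → ℚ
pow p k = + (p ℕ.^ k) ℚ./ 1

invPow : (p k : ℕ) .{{_ : NonZero p}} → ℚ
invPow p k = (+ 1) ℚ./ (p ℕ.^ k)
  where instance _ = m^n≢0 p k

imbalance : ∀ {p n m} .{{_ : NonZero p}} → (𝔽 p n → 𝔽 p m) → Cyc p
imbalance {p} {n} {m} F =
  scaleᶜ (invPow p m)
    (sumᶜ (map (λ b → absSqᶜ (walsh F b zeroVec))
               (filter (λ b → Relation.Nullary.¬? (b ≟v zeroVec)) (allVecs p m))))

module Submission where

-- Comparing the coefficients of ζ⁰ and ζ¹ in the identity N_F = N, orthogonality of the additive
-- characters of 𝔽_p^m turns the imbalance into a collision count: N = Σ_α |F⁻¹(α)|² − p^(2n−m).
-- Fix β; the other p^m − 1 fibres have sizes n_α summing to p^n − |F⁻¹(β)|, and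
--   (1 − p^(−m)) N − (|F⁻¹(β)| − p^(n−m))² = p^(−m) ((p^m − 1) Σ n_α² − (Σ n_α)²),
-- which is nonnegative by Cauchy–Schwarz and vanishes exactly when all n_α are equal.

open import Defs
open import Data.Nat as ℕ using (ℕ; zero; suc; NonZero)
open import Data.Nat.DivMod using (_mod_)
import Data.Nat.Properties as ℕP
open import Data.Nat.Primality using (Prime; prime⇒nonTrivial)
open import Data.Fin as Fin using (Fin; toℕ)
import Data.Fin.Properties as Fin
open import Data.Vec using ([]; _∷_)
import Data.Vec.Properties as Vec
open import Data.List using (List; []; _∷_; _++_; map; concatMap; filter; length; allFin)
import Data.List.Properties as List
open import Data.List.Membership.Propositional using (_∈_)
open import Data.List.Membership.Propositional.Properties
  using (∈-allFin; ∈-map⁺; ∈-concatMap⁺; ∈-filter⁺)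
open import Data.List.Relation.Unary.Any as Any using (here; there)
open import Data.Bool using (if_then_else_)
open import Data.Empty using (⊥-elim)
open import Data.Product using (∃; _,_; map₂; _×_)
open import Data.Sum using (inj₁; inj₂)
open import Function using (id; _∘_; _⇔_; mk⇔; Equivalence)
open import Function.Properties.Equivalence using () renaming (trans to ⇔-trans)
open import Relation.Nullary using (Dec; yes; no; ¬_; ¬?; map′)
open import Relation.Nullary.Decidable using (⌊_⌋; _×-dec_)
open import Relation.Binary using (Setoid; IsEquivalence; Decidable)
import Relation.Binary.Reasoning.Setoid as SetoidReasoning
open import Relation.Binary.PropositionalEquality
  using (_≡_; _≢_; refl; sym; trans; cong; cong₂; module ≡-Reasoning)

-- Congruence modulo p

module Congruence (p : ℕ) .{{_ : NonZero p}} where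
  open import Data.Nat using (_+_; _*_; _∸_; _%_; _≟_; _<_; ≢-nonZero; >-nonZero⁻¹)
  open import Data.Nat.Properties
  open import Data.Nat.DivMod
  open import Data.Nat.Coprimality using (coprime-Bézout; prime⇒coprime)
  open import Data.Nat.GCD using (module Bézout)
  open import Data.Nat.Tactic.RingSolver using (solve-∀)

  infix 4 _≈_ _≈?_
  record _≈_ (a b : ℕ) : Set where
    constructor congruent
    field %-≡ : a % p ≡ b % p
  open _≈_ public

  ≈-isEquivalence : IsEquivalence _≈_
  ≈-isEquivalence = record
    { refl  = congruent refl
    ; sym   = λ (congruent e) → congruent (sym e)
    ; trans = λ (congruent e) (congruent f) → congruent (trans e f)
    }

  ≈-setoid : Setoid _ _
  ≈-setoid = record { isEquivalence = ≈-isEquivalence }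

  open IsEquivalence ≈-isEquivalence public
    using () renaming (refl to ≈-refl; sym to ≈-sym; trans to ≈-trans; reflexive to ≈-reflexive)
  module ≈-Reasoning = SetoidReasoning ≈-setoid

  _≈?_ : Decidable _≈_
  a ≈? b = map′ congruent %-≡ (a % p ≟ b % p)

  ≈-resp-⇔ : ∀ {a a′ b b′} → a ≈ a′ → b ≈ b′ → (a ≈ b) ⇔ (a′ ≈ b′)
  ≈-resp-⇔ a≈a′ b≈b′ = mk⇔ (λ a≈b → ≈-trans (≈-sym a≈a′) (≈-trans a≈b b≈b′))
                            (λ a′≈b′ → ≈-trans a≈a′ (≈-trans a′≈b′ (≈-sym b≈b′)))

  +-cong : ∀ {a b c d} → a ≈ b → c ≈ d → a + c ≈ b + d
  +-cong {a} {b} {c} {d} (congruent a≈b) (congruent c≈d) = congruent (begin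
    (a + c) % p             ≡⟨ %-distribˡ-+ a c p ⟩
    (a % p + c % p) % p     ≡⟨ cong₂ (λ x y → (x + y) % p) a≈b c≈d ⟩
    (b % p + d % p) % p     ≡⟨ %-distribˡ-+ b d p ⟨
    (b + d) % p             ∎)
    where open ≡-Reasoning

  *-cong : ∀ {a b c d} → a ≈ b → c ≈ d → a * c ≈ b * d
  *-cong {a} {b} {c} {d} (congruent a≈b) (congruent c≈d) = congruent (begin
    (a * c) % p             ≡⟨ %-distribˡ-* a c p ⟩
    (a % p * (c % p)) % p   ≡⟨ cong₂ (λ x y → (x * y) % p) a≈b c≈d ⟩
    (b % p * (d % p)) % p   ≡⟨ %-distribˡ-* b d p ⟨
    (b * d) % p             ∎)
    where open ≡-Reasoning

  m%p≈m : ∀ m → m % p ≈ m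
  m%p≈m m = congruent (m%n%n≡m%n m p)

  m+p≈m : ∀ m → m + p ≈ m
  m+p≈m m = congruent ([m+n]%n≡m%n m p)

  0%p≡0 : 0 % p ≡ 0
  0%p≡0 = m<n⇒m%n≡m (>-nonZero⁻¹ p)

  m*p≈0 : ∀ m → m * p ≈ 0
  m*p≈0 m = congruent (trans (m*n%n≡0 m p) (sym 0%p≡0))

  minus : ℕ → ℕ
  minus m = p ∸ m % p

  +-minus : ∀ m → m + minus m ≈ 0
  +-minus m = begin
    m + minus m         ≈⟨ +-cong (≈-sym (m%p≈m m)) ≈-refl ⟩
    m % p + minus m     ≡⟨ m+[n∸m]≡n (m%n≤n m p) ⟩
    p                   ≡⟨ +-identityˡ p ⟨
    0 + p               ≈⟨ m+p≈m 0 ⟩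
    0                   ∎
    where open ≈-Reasoning

  +-cancelʳ : ∀ {a b c} → a + c ≈ b + c → a ≈ b
  +-cancelʳ {a} {b} {c} a+c≈b+c = begin
    a                       ≡⟨ +-identityʳ a ⟨
    a + 0                   ≈⟨ +-cong ≈-refl (≈-sym (+-minus c)) ⟩
    a + (c + minus c)       ≡⟨ +-assoc a c _ ⟨
    a + c + minus c         ≈⟨ +-cong a+c≈b+c ≈-refl ⟩
    b + c + minus c         ≡⟨ +-assoc b c _ ⟩
    b + (c + minus c)       ≈⟨ +-cong ≈-refl (+-minus c) ⟩
    b + 0                   ≡⟨ +-identityʳ b ⟩
    b                       ∎
    where open ≈-Reasoning

  +-cancelˡ : ∀ {a b c} → c + a ≈ c + b → a ≈ b
  +-cancelˡ {a} {b} {c} c+a≈c+b =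
    +-cancelʳ (≈-trans (≈-reflexive (+-comm a c)) (≈-trans c+a≈c+b (≈-reflexive (+-comm c b))))

  toℕ-mod : ∀ m → toℕ (m mod p) ≈ m
  toℕ-mod m = ≈-trans (≈-reflexive (Fin.toℕ-fromℕ< (m%n<n m p))) (m%p≈m m)

  ≉⇒mod-≢ : ∀ {a b} → ¬ a ≈ b → a mod p ≢ b mod p
  ≉⇒mod-≢ {a} {b} a≉b a≡b =
    a≉b (≈-trans (≈-sym (toℕ-mod a)) (≈-trans (≈-reflexive (cong toℕ a≡b)) (toℕ-mod b)))

  toℕ-≈-injective : ∀ {i j : Fin p} → toℕ i ≈ toℕ j → i ≡ j
  toℕ-≈-injective {i} {j} (congruent i≈j) =
    Fin.toℕ-injective (trans (sym (m<n⇒m%n≡m (Fin.toℕ<n i))) (trans i≈j (m<n⇒m%n≡m (Fin.toℕ<n j))))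

  toℕ-⊖ : ∀ (i j : Fin p) → toℕ (i ⊖ j) + toℕ j ≈ toℕ i
  toℕ-⊖ i j = begin
    toℕ (i ⊖ j) + toℕ j               ≈⟨ +-cong (toℕ-mod _) ≈-refl ⟩
    toℕ i + (p ∸ toℕ j) + toℕ j       ≡⟨ +-assoc (toℕ i) _ _ ⟩
    toℕ i + (p ∸ toℕ j + toℕ j)       ≡⟨ cong (toℕ i +_) (m∸n+n≡m (Fin.toℕ≤n j)) ⟩
    toℕ i + p                         ≈⟨ m+p≈m (toℕ i) ⟩
    toℕ i                             ∎
    where open ≈-Reasoning

  -- conjᶜ and _*ᶜ_ read coefficients at 0 ⊖ (j ⊖ i), which is the index k with i ≡ j + k.
  0⊖[j⊖i]≡k⇔i≈j+k : ∀ (i j k : Fin p) → ((0 mod p) ⊖ (j ⊖ i) ≡ k) ⇔ (toℕ i ≈ toℕ j + toℕ k)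
  0⊖[j⊖i]≡k⇔i≈j+k i j k = mk⇔ (λ { refl → ≈-sym j+σ≈i })
                               (λ i≈j+k → toℕ-≈-injective (+-cancelˡ (≈-trans j+σ≈i i≈j+k)))
    where
    σ = (0 mod p) ⊖ (j ⊖ i)
    rearrange : ∀ a b c → a + b + c ≡ c + a + b
    rearrange = solve-∀
    j+σ≈i : toℕ j + toℕ σ ≈ toℕ i
    j+σ≈i = begin
      toℕ j + toℕ σ                         ≈⟨ +-cong (≈-sym (toℕ-⊖ j i)) ≈-refl ⟩
      toℕ (j ⊖ i) + toℕ i + toℕ σ           ≡⟨ rearrange (toℕ (j ⊖ i)) (toℕ i) (toℕ σ) ⟩
      toℕ σ + toℕ (j ⊖ i) + toℕ i           ≈⟨ +-cong (toℕ-⊖ (0 mod p) (j ⊖ i)) ≈-refl ⟩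
      toℕ (0 mod p) + toℕ i                 ≈⟨ +-cong (toℕ-mod 0) ≈-refl ⟩
      toℕ i                                 ∎
      where open ≈-Reasoning

  1<p⇒0≉1 : 1 < p → ¬ 0 ≈ 1
  1<p⇒0≉1 1<p (congruent 0≡1) = 0≢1+n (trans (sym 0%p≡0) (trans 0≡1 (m<n⇒m%n≡m 1<p)))

  toℕ-⟨,⟩ : ∀ {m} (u v : 𝔽 p m) → toℕ ⟨ u , v ⟩ ≈ dotℕ u v
  toℕ-⟨,⟩ u v = toℕ-mod (dotℕ u v)

  dotℕ-zeroVecˡ : ∀ {m} (v : 𝔽 p m) → dotℕ zeroVec v ≈ 0
  dotℕ-zeroVecˡ []      = ≈-refl
  dotℕ-zeroVecˡ (b ∷ v) = +-cong (*-cong (toℕ-mod 0) (≈-refl {toℕ b})) (dotℕ-zeroVecˡ v)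

  -- The exponent of ζ in the Walsh transform at a = 0.
  toℕ-⟨b,y⟩⊖⟨0,x⟩ : ∀ {m n} (b y : 𝔽 p m) (x : 𝔽 p n) →
    toℕ (⟨ b , y ⟩ ⊖ ⟨ zeroVec , x ⟩) ≈ dotℕ b y
  toℕ-⟨b,y⟩⊖⟨0,x⟩ b y x = begin
    toℕ (e ⊖ z)             ≡⟨ +-identityʳ _ ⟨
    toℕ (e ⊖ z) + 0         ≈⟨ +-cong ≈-refl (≈-sym z≈0) ⟩
    toℕ (e ⊖ z) + toℕ z     ≈⟨ toℕ-⊖ e z ⟩
    toℕ e                   ≈⟨ toℕ-⟨,⟩ b y ⟩
    dotℕ b y                ∎
    where
    open ≈-Reasoning
    e = ⟨ b , y ⟩
    z = ⟨ zeroVec , x ⟩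
    z≈0 : toℕ z ≈ 0
    z≈0 = ≈-trans (toℕ-⟨,⟩ zeroVec x) (dotℕ-zeroVecˡ x)

  module _ (p-prime : Prime p) where

    inverse : ∀ {e} → ¬ e ≈ 0 → ∃ λ y → y * e ≈ 1
    inverse {e} e≉0 = fromBézout (coprime-Bézout (prime⇒coprime p-prime (m%n<n e p)))
      where
      instance
        e%p≢0 : NonZero (e % p)
        e%p≢0 = ≢-nonZero (λ e%p≡0 → e≉0 (congruent (trans e%p≡0 (sym 0%p≡0))))
      y*e%p≈y*e : ∀ y → y * (e % p) ≈ y * e
      y*e%p≈y*e y = *-cong (≈-refl {y}) (m%p≈m e)
      fromBézout : Bézout.Identity 1 p (e % p) → ∃ λ y → y * e ≈ 1
      fromBézout (Bézout.-+ x y 1+xp≡ye%p) = y , (begin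
        y * e               ≈⟨ y*e%p≈y*e y ⟨
        y * (e % p)         ≡⟨ 1+xp≡ye%p ⟨
        1 + x * p           ≈⟨ +-cong ≈-refl (m*p≈0 x) ⟩
        1 + 0               ∎)
        where open ≈-Reasoning
      -- Here y e ≡ −1, so minus y is the inverse.
      fromBézout (Bézout.+- x y 1+ye%p≡xp) = minus y , (begin
        minus y * e                       ≡⟨ +-identityʳ _ ⟨
        minus y * e + 0                   ≈⟨ +-cong ≈-refl 0≈1+ye ⟩
        minus y * e + (1 + y * e)         ≡⟨ rearrange (minus y) y e ⟩
        1 + (y + minus y) * e             ≈⟨ +-cong ≈-refl (*-cong (+-minus y) ≈-refl) ⟩
        1 + 0 * e                         ≡⟨⟩
        1                                 ∎)
        where
        open ≈-Reasoning
        0≈1+ye : 0 ≈ 1 + y * e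
        0≈1+ye = begin
          0                   ≈⟨ m*p≈0 x ⟨
          x * p               ≡⟨ 1+ye%p≡xp ⟨
          1 + y * (e % p)     ≈⟨ +-cong ≈-refl (y*e%p≈y*e y) ⟩
          1 + y * e           ∎
        rearrange : ∀ a y e → a * e + (1 + y * e) ≡ 1 + (y + a) * e
        rearrange = solve-∀

    *-cancelʳ : ∀ {a b e} → ¬ e ≈ 0 → a * e ≈ b * e → a ≈ b
    *-cancelʳ {a} {b} {e} e≉0 ae≈be with y , ye≈1 ← inverse e≉0 = begin
      a                 ≡⟨ *-identityʳ a ⟨
      a * 1             ≈⟨ *-cong (≈-refl {a}) ye≈1 ⟨
      a * (y * e)       ≡⟨ rearrange a y e ⟩
      a * e * y         ≈⟨ *-cong ae≈be ≈-refl ⟩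
      b * e * y         ≡⟨ rearrange b y e ⟨
      b * (y * e)       ≈⟨ *-cong (≈-refl {b}) ye≈1 ⟩
      b * 1             ≡⟨ *-identityʳ b ⟩
      b                 ∎
      where
      open ≈-Reasoning
      rearrange : ∀ a y e → a * (y * e) ≡ a * e * y
      rearrange = solve-∀

    linear-solution : ∀ {e} → ¬ e ≈ 0 → ∀ r →
      ∃ λ (a₀ : Fin p) → ∀ a → (toℕ a * e ≈ r) ⇔ (a₀ ≡ a)
    linear-solution {e} e≉0 r with y , ye≈1 ← inverse e≉0 =
      a₀ , λ a → mk⇔ (λ ae≈r → toℕ-≈-injective (*-cancelʳ e≉0 (≈-trans a₀e≈r (≈-sym ae≈r))))
                     (λ { refl → a₀e≈r })
      where
      a₀ = (y * r) mod p
      a₀e≈r : toℕ a₀ * e ≈ r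
      a₀e≈r = begin
        toℕ a₀ * e      ≈⟨ *-cong (toℕ-mod (y * r)) ≈-refl ⟩
        y * r * e       ≡⟨ rearrange y r e ⟩
        r * (y * e)     ≈⟨ *-cong (≈-refl {r}) ye≈1 ⟩
        r * 1           ≡⟨ *-identityʳ r ⟩
        r               ∎
        where
        open ≈-Reasoning
        rearrange : ∀ y r e → y * r * e ≡ r * (y * e)
        rearrange = solve-∀

    affine-solution : ∀ {g d : Fin p} → g ≢ d → ∀ s t →
      ∃ λ (a₀ : Fin p) → ∀ a → (s + toℕ a * toℕ g ≈ t + toℕ a * toℕ d) ⇔ (a₀ ≡ a)
    affine-solution {g} {d} g≢d s t =
      map₂ (λ solves a → mk⇔ (Equivalence.to (solves a) ∘ affine⇒linear a)
                             (linear⇒affine a ∘ Equivalence.from (solves a)))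
           (linear-solution e≉0 (t + minus s))
      where
      e = toℕ (g ⊖ d)
      e+d≈g : e + toℕ d ≈ toℕ g
      e+d≈g = toℕ-⊖ g d
      e≉0 : ¬ e ≈ 0
      e≉0 e≈0 = g≢d (toℕ-≈-injective (≈-trans (≈-sym e+d≈g) (+-cong e≈0 ≈-refl)))
      s+[t-s]≈t : s + (t + minus s) ≈ t
      s+[t-s]≈t = begin
        s + (t + minus s)     ≡⟨ solve s t (minus s) ⟩
        t + (s + minus s)     ≈⟨ +-cong ≈-refl (+-minus s) ⟩
        t + 0                 ≡⟨ +-identityʳ t ⟩
        t                     ∎
        where
        open ≈-Reasoning
        solve : ∀ s t m → s + (t + m) ≡ t + (s + m)
        solve = solve-∀
      split : ∀ a → s + a * toℕ g ≈ s + a * e + a * toℕ d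
      split a = ≈-trans (+-cong ≈-refl (*-cong (≈-refl {a}) (≈-sym e+d≈g)))
                        (≈-reflexive (solve s a e (toℕ d)))
        where solve : ∀ s a e d → s + a * (e + d) ≡ s + a * e + a * d
              solve = solve-∀
      affine⇒linear : ∀ a → s + toℕ a * toℕ g ≈ t + toℕ a * toℕ d → toℕ a * e ≈ t + minus s
      affine⇒linear a h = +-cancelˡ (≈-trans (+-cancelʳ (≈-trans (≈-sym (split (toℕ a))) h)) (≈-sym s+[t-s]≈t))
      linear⇒affine : ∀ a → toℕ a * e ≈ t + minus s → s + toℕ a * toℕ g ≈ t + toℕ a * toℕ d
      linear⇒affine a h = ≈-trans (split (toℕ a)) (+-cong (≈-trans (+-cong ≈-refl h) s+[t-s]≈t) ≈-refl)

-- ℚ's arithmetic is opened only now: its operators would clash with ℕ's in the module above.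
import Data.Integer as ℤ
import Data.Integer.Properties as ℤ
open import Data.Rational
  using (ℚ; 0ℚ; 1ℚ; _+_; _*_; _-_; -_; _≤_; _/_; mkℚ; 1/_; Positive; NonNegative; nonNegative; nonPositive; ≢-nonZero)
open import Data.Rational.Properties
open import Data.Nat.Coprimality as Coprime using (1-coprimeTo)
open import Algebra.Properties.Group +-0-group using (x∙y⁻¹≈ε⇒x≈y)
open import Algebra.Bundles using (CommutativeMonoid)
open import Algebra.Properties.CommutativeSemigroup
  (CommutativeMonoid.commutativeSemigroup +-0-commutativeMonoid) using (interchange)
open import Data.Maybe using (Maybe; just; nothing)
open import Tactic.RingSolver using (solve-∀)
open import Tactic.RingSolver.Core.AlmostCommutativeRing using (AlmostCommutativeRing; fromCommutativeRing)

ℚ-ring : AlmostCommutativeRing _ _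
ℚ-ring = fromCommutativeRing +-*-commutativeRing isZero
  where
  isZero : ∀ x → Maybe (0ℚ ≡ x)
  isZero x with 0ℚ ≟ x
  ... | yes 0≡x = just 0≡x
  ... | no _    = nothing

private
  variable
    A B : Set
    P Q : Set

∑ : List A → (A → ℚ) → ℚ
∑ []       f = 0ℚ
∑ (x ∷ xs) f = f x + ∑ xs f

syntax ∑ xs (λ x → e) = ∑[ x ∈ xs ] e

∑-cong : ∀ (xs : List A) {f g : A → ℚ} → (∀ x → f x ≡ g x) → ∑ xs f ≡ ∑ xs g
∑-cong []       f≗g = refl
∑-cong (x ∷ xs) f≗g = cong₂ _+_ (f≗g x) (∑-cong xs f≗g)

∑-++ : ∀ (xs ys : List A) f → ∑ (xs ++ ys) f ≡ ∑ xs f + ∑ ys f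
∑-++ []       ys f = sym (+-identityˡ _)
∑-++ (x ∷ xs) ys f = trans (cong (f x +_) (∑-++ xs ys f)) (sym (+-assoc (f x) _ _))

∑-map : ∀ (g : A → B) xs f → ∑ (map g xs) f ≡ ∑ xs (f ∘ g)
∑-map g []       f = refl
∑-map g (x ∷ xs) f = cong (f (g x) +_) (∑-map g xs f)

∑-concatMap : ∀ (g : A → List B) xs f → ∑ (concatMap g xs) f ≡ ∑[ x ∈ xs ] ∑ (g x) f
∑-concatMap g []       f = refl
∑-concatMap g (x ∷ xs) f = trans (∑-++ (g x) _ f) (cong (∑ (g x) f +_) (∑-concatMap g xs f))

∑-zero : ∀ (xs : List A) → ∑[ _ ∈ xs ] 0ℚ ≡ 0ℚ
∑-zero []       = refl
∑-zero (x ∷ xs) = trans (+-identityˡ _) (∑-zero xs)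

∑-distrib-+ : ∀ (xs : List A) f g → ∑[ x ∈ xs ] (f x + g x) ≡ ∑ xs f + ∑ xs g
∑-distrib-+ []       f g = refl
∑-distrib-+ (x ∷ xs) f g =
  trans (cong (f x + g x +_) (∑-distrib-+ xs f g)) (interchange (f x) (g x) (∑ xs f) (∑ xs g))

∑-neg : ∀ (xs : List A) f → ∑[ x ∈ xs ] (- f x) ≡ - ∑ xs f
∑-neg []       f = refl
∑-neg (x ∷ xs) f = trans (cong (- f x +_) (∑-neg xs f)) (sym (neg-distrib-+ (f x) (∑ xs f)))

∑-distrib-- : ∀ (xs : List A) f g → ∑[ x ∈ xs ] (f x - g x) ≡ ∑ xs f - ∑ xs g
∑-distrib-- xs f g = trans (∑-distrib-+ xs f (-_ ∘ g)) (cong (∑ xs f +_) (∑-neg xs g))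

∑-*ˡ : ∀ c (xs : List A) f → ∑[ x ∈ xs ] (c * f x) ≡ c * ∑ xs f
∑-*ˡ c []       f = sym (*-zeroʳ c)
∑-*ˡ c (x ∷ xs) f = trans (cong (c * f x +_) (∑-*ˡ c xs f)) (sym (*-distribˡ-+ c (f x) (∑ xs f)))

∑-*ʳ : ∀ c (xs : List A) f → ∑[ x ∈ xs ] (f x * c) ≡ ∑ xs f * c
∑-*ʳ c xs f = trans (∑-cong xs (λ x → *-comm (f x) c)) (trans (∑-*ˡ c xs f) (*-comm c (∑ xs f)))

∑-comm : ∀ (xs : List A) (ys : List B) (f : A → B → ℚ) →
  ∑[ x ∈ xs ] ∑[ y ∈ ys ] f x y ≡ ∑[ y ∈ ys ] ∑[ x ∈ xs ] f x y
∑-comm []       ys f = sym (∑-zero ys)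
∑-comm (x ∷ xs) ys f =
  trans (cong (∑ ys (f x) +_) (∑-comm xs ys f)) (sym (∑-distrib-+ ys (f x) (λ y → ∑ xs (λ x′ → f x′ y))))

∑-nonNeg : ∀ (xs : List A) {f} → (∀ x → 0ℚ ≤ f x) → 0ℚ ≤ ∑ xs f
∑-nonNeg []       f≥0 = ≤-refl
∑-nonNeg (x ∷ xs) f≥0 = +-mono-≤ (f≥0 x) (∑-nonNeg xs f≥0)

∈⇒≤∑ : ∀ {xs : List A} {f x} → (∀ y → 0ℚ ≤ f y) → x ∈ xs → f x ≤ ∑ xs f
∈⇒≤∑ {xs = y ∷ xs} {f} f≥0 (here refl) =
  ≤-trans (≤-reflexive (sym (+-identityʳ (f y)))) (+-monoʳ-≤ (f y) (∑-nonNeg xs f≥0))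
∈⇒≤∑ {xs = y ∷ xs} {f} f≥0 (there x∈xs) =
  ≤-trans (≤-reflexive (sym (+-identityˡ _))) (+-mono-≤ (f≥0 y) (∈⇒≤∑ f≥0 x∈xs))

sumℚ-map : ∀ (f : A → ℚ) xs → sumℚ (map f xs) ≡ ∑ xs f
sumℚ-map f []       = refl
sumℚ-map f (x ∷ xs) = cong (f x +_) (sumℚ-map f xs)

sumᶜ-coefficient : ∀ {p} (f : A → Cyc p) xs j → sumᶜ (map f xs) j ≡ ∑[ x ∈ xs ] f x j
sumᶜ-coefficient f []       j = refl
sumᶜ-coefficient f (x ∷ xs) j = cong (f x j +_) (sumᶜ-coefficient f xs j)

-- Indicators; phrased with ⌊_⌋ like ζ^ in Defs, so that ζ^ k i is 𝟙 (i Fin.≟ k) by definition.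

𝟙 : ∀ {P : Set} → Dec P → ℚ
𝟙 P? = if ⌊ P? ⌋ then 1ℚ else 0ℚ

𝟙-yes : (P? : Dec P) → P → 𝟙 P? ≡ 1ℚ
𝟙-yes (yes _) _  = refl
𝟙-yes (no ¬p) p = ⊥-elim (¬p p)

𝟙-no : (P? : Dec P) → ¬ P → 𝟙 P? ≡ 0ℚ
𝟙-no (yes p) ¬p = ⊥-elim (¬p p)
𝟙-no (no _)  _  = refl

𝟙-cong : (P? : Dec P) (Q? : Dec Q) → P ⇔ Q → 𝟙 P? ≡ 𝟙 Q?
𝟙-cong (yes p) Q? P⇔Q = sym (𝟙-yes Q? (Equivalence.to P⇔Q p))
𝟙-cong (no ¬p) Q? P⇔Q = sym (𝟙-no Q? (¬p ∘ Equivalence.from P⇔Q))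

𝟙-¬ : (P? : Dec P) → 𝟙 (¬? P?) ≡ 1ℚ - 𝟙 P?
𝟙-¬ (yes _) = refl
𝟙-¬ (no _)  = refl

𝟙-× : (P? : Dec P) (Q? : Dec Q) → 𝟙 (P? ×-dec Q?) ≡ 𝟙 P? * 𝟙 Q?
𝟙-× (yes _) (yes _) = refl
𝟙-× (yes _) (no _)  = refl
𝟙-× (no _)  Q?      = sym (*-zeroˡ (𝟙 Q?))

𝟙-≡-sym : ∀ {x y : A} (x≟y : Dec (x ≡ y)) (y≟x : Dec (y ≡ x)) → 𝟙 x≟y ≡ 𝟙 y≟x
𝟙-≡-sym x≟y y≟x = 𝟙-cong x≟y y≟x (mk⇔ sym sym)

∑-filter : ∀ {P : A → Set} (P? : ∀ x → Dec (P x)) xs f →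
  ∑ (filter P? xs) f ≡ ∑[ x ∈ xs ] (𝟙 (P? x) * f x)
∑-filter P? []       f = refl
∑-filter P? (x ∷ xs) f with P? x
... | yes _ = cong₂ _+_ (sym (*-identityˡ (f x))) (∑-filter P? xs f)
... | no _  = trans (∑-filter P? xs f) (sym (trans (cong (_+ _) (*-zeroˡ (f x))) (+-identityˡ _)))

fromℕ : ℕ → ℚ
fromℕ n = ℤ.+ n / 1

fromℕ≡mkℚ : ∀ n → fromℕ n ≡ mkℚ (ℤ.+ n) 0 (Coprime.sym (1-coprimeTo n))
fromℕ≡mkℚ n = normalize-coprime _

fromℕ-+ : ∀ m n → fromℕ (m ℕ.+ n) ≡ fromℕ m + fromℕ n
fromℕ-+ m n = begin
  ℤ.+ (m ℕ.+ n) / 1                           ≡⟨ /-cong numerator refl ⟩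
  (ℤ.+ m ℤ.* ℤ.+ 1 ℤ.+ ℤ.+ n ℤ.* ℤ.+ 1) / 1   ≡⟨ cong₂ _+_ (fromℕ≡mkℚ m) (fromℕ≡mkℚ n) ⟨
  fromℕ m + fromℕ n                           ∎
  where
  open ≡-Reasoning
  numerator : ℤ.+ (m ℕ.+ n) ≡ ℤ.+ m ℤ.* ℤ.+ 1 ℤ.+ ℤ.+ n ℤ.* ℤ.+ 1
  numerator = trans (ℤ.pos-+ m n) (sym (cong₂ ℤ._+_ (ℤ.*-identityʳ (ℤ.+ m)) (ℤ.*-identityʳ (ℤ.+ n))))

fromℕ-* : ∀ m n → fromℕ (m ℕ.* n) ≡ fromℕ m * fromℕ n
fromℕ-* m n = begin
  ℤ.+ (m ℕ.* n) / 1         ≡⟨ /-cong (ℤ.pos-* m n) refl ⟩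
  (ℤ.+ m ℤ.* ℤ.+ n) / 1     ≡⟨ cong₂ _*_ (fromℕ≡mkℚ m) (fromℕ≡mkℚ n) ⟨
  fromℕ m * fromℕ n         ∎
  where open ≡-Reasoning

1/n*n≡1 : ∀ n .{{_ : NonZero n}} → (ℤ.+ 1 / n) * fromℕ n ≡ 1ℚ
1/n*n≡1 n@(suc _) = begin
  (ℤ.+ 1 / n) * fromℕ n     ≡⟨ cong₂ _*_ (normalize-coprime (1-coprimeTo n)) (fromℕ≡mkℚ n) ⟩
  1/ n/1 * n/1              ≡⟨ *-inverseˡ n/1 ⟩
  1ℚ                        ∎
  where
  open ≡-Reasoning
  n/1 = mkℚ (ℤ.+ n) 0 (Coprime.sym (1-coprimeTo n))

fromℕ-*-cancelˡ : ∀ n .{{_ : NonZero n}} {x y} → fromℕ n * x ≡ fromℕ n * y → x ≡ y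
fromℕ-*-cancelˡ n {x} {y} nx≡ny = begin
  x                         ≡⟨ *-identityˡ x ⟨
  1ℚ * x                    ≡⟨ cong (_* x) (1/n*n≡1 n) ⟨
  1/n * fromℕ n * x         ≡⟨ *-assoc 1/n (fromℕ n) x ⟩
  1/n * (fromℕ n * x)       ≡⟨ cong (1/n *_) nx≡ny ⟩
  1/n * (fromℕ n * y)       ≡⟨ *-assoc 1/n (fromℕ n) y ⟨
  1/n * fromℕ n * y         ≡⟨ cong (_* y) (1/n*n≡1 n) ⟩
  1ℚ * y                    ≡⟨ *-identityˡ y ⟩
  y                         ∎
  where
  open ≡-Reasoning
  1/n = ℤ.+ 1 / n

invPow*pow≡1 : ∀ p m .{{_ : NonZero p}} → invPow p m * pow p m ≡ 1ℚ
invPow*pow≡1 p m = 1/n*n≡1 (p ℕ.^ m) {{ℕP.m^n≢0 p m}}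

∑-const : ∀ (xs : List A) c → ∑[ _ ∈ xs ] c ≡ fromℕ (length xs) * c
∑-const []       c = sym (*-zeroˡ c)
∑-const (x ∷ xs) c = begin
  c + ∑[ _ ∈ xs ] c                 ≡⟨ cong₂ _+_ (sym (*-identityˡ c)) (∑-const xs c) ⟩
  1ℚ * c + fromℕ (length xs) * c    ≡⟨ *-distribʳ-+ c 1ℚ (fromℕ (length xs)) ⟨
  (1ℚ + fromℕ (length xs)) * c      ≡⟨ cong (_* c) (fromℕ-+ 1 (length xs)) ⟨
  fromℕ (suc (length xs)) * c       ∎
  where open ≡-Reasoning

length-filter : ∀ {P : A → Set} (P? : ∀ x → Dec (P x)) xs →
  fromℕ (length (filter P? xs)) ≡ ∑[ x ∈ xs ] 𝟙 (P? x)
length-filter P? xs = begin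
  fromℕ (length (filter P? xs))               ≡⟨ *-identityʳ _ ⟨
  fromℕ (length (filter P? xs)) * 1ℚ          ≡⟨ ∑-const (filter P? xs) 1ℚ ⟨
  ∑[ _ ∈ filter P? xs ] 1ℚ                    ≡⟨ ∑-filter P? xs (λ _ → 1ℚ) ⟩
  ∑[ x ∈ xs ] (𝟙 (P? x) * 1ℚ)                 ≡⟨ ∑-cong xs (λ x → *-identityʳ (𝟙 (P? x))) ⟩
  ∑[ x ∈ xs ] 𝟙 (P? x)                        ∎
  where open ≡-Reasoning

∑-allFin-suc : ∀ n (f : Fin (suc n) → ℚ) → ∑ (allFin (suc n)) f ≡ f Fin.zero + ∑[ i ∈ allFin n ] f (Fin.suc i)
∑-allFin-suc n f = cong (f Fin.zero +_) (trans (cong (λ is → ∑ is f) (sym (List.map-tabulate id Fin.suc)))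
                                               (∑-map Fin.suc (allFin n) f))

∑-allFin-δ : ∀ n (i : Fin n) (h : Fin n → ℚ) → ∑[ a ∈ allFin n ] (𝟙 (i Fin.≟ a) * h a) ≡ h i
∑-allFin-δ (suc n) Fin.zero h = begin
  ∑ (allFin (suc n)) (λ a → 𝟙 (Fin.zero Fin.≟ a) * h a)
    ≡⟨ ∑-allFin-suc n (λ a → 𝟙 (Fin.zero Fin.≟ a) * h a) ⟩
  1ℚ * h Fin.zero + ∑[ a ∈ allFin n ] (0ℚ * h (Fin.suc a))
    ≡⟨ cong₂ _+_ (*-identityˡ (h Fin.zero)) (∑-cong (allFin n) (λ a → *-zeroˡ (h (Fin.suc a)))) ⟩
  h Fin.zero + ∑[ _ ∈ allFin n ] 0ℚ
    ≡⟨ cong (h Fin.zero +_) (∑-zero (allFin n)) ⟩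
  h Fin.zero + 0ℚ
    ≡⟨ +-identityʳ (h Fin.zero) ⟩
  h Fin.zero ∎
  where open ≡-Reasoning
∑-allFin-δ (suc n) (Fin.suc i) h = begin
  ∑ (allFin (suc n)) (λ a → 𝟙 (Fin.suc i Fin.≟ a) * h a)
    ≡⟨ ∑-allFin-suc n (λ a → 𝟙 (Fin.suc i Fin.≟ a) * h a) ⟩
  0ℚ * h Fin.zero + ∑[ a ∈ allFin n ] (𝟙 (Fin.suc i Fin.≟ Fin.suc a) * h (Fin.suc a))
    ≡⟨ cong₂ _+_ (*-zeroˡ (h Fin.zero)) (∑-cong (allFin n) (λ a → cong (_* h (Fin.suc a)) (𝟙-suc a))) ⟩
  0ℚ + ∑[ a ∈ allFin n ] (𝟙 (i Fin.≟ a) * h (Fin.suc a))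
    ≡⟨ +-identityˡ _ ⟩
  ∑[ a ∈ allFin n ] (𝟙 (i Fin.≟ a) * h (Fin.suc a))
    ≡⟨ ∑-allFin-δ n i (h ∘ Fin.suc) ⟩
  h (Fin.suc i) ∎
  where
  open ≡-Reasoning
  𝟙-suc : ∀ a → 𝟙 (Fin.suc i Fin.≟ Fin.suc a) ≡ 𝟙 (i Fin.≟ a)
  𝟙-suc a = 𝟙-cong (Fin.suc i Fin.≟ Fin.suc a) (i Fin.≟ a) (mk⇔ Fin.suc-injective (cong Fin.suc))

∑-allFin-unique : ∀ {n} {P : Fin n → Set} (P? : ∀ a → Dec (P a)) →
  (∃ λ a₀ → ∀ a → P a ⇔ a₀ ≡ a) → ∑[ a ∈ allFin n ] 𝟙 (P? a) ≡ 1ℚ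
∑-allFin-unique {n} P? (a₀ , P⇔a₀≡) = begin
  ∑[ a ∈ allFin n ] 𝟙 (P? a)
    ≡⟨ ∑-cong (allFin n) (λ a → trans (𝟙-cong (P? a) (a₀ Fin.≟ a) (P⇔a₀≡ a)) (sym (*-identityʳ _))) ⟩
  ∑[ a ∈ allFin n ] (𝟙 (a₀ Fin.≟ a) * 1ℚ)
    ≡⟨ ∑-allFin-δ n a₀ (λ _ → 1ℚ) ⟩
  1ℚ ∎
  where open ≡-Reasoning

∑-allFin-const : ∀ n c → ∑[ _ ∈ allFin n ] c ≡ fromℕ n * c
∑-allFin-const n c = trans (∑-const (allFin n) c) (cong (λ k → fromℕ k * c) (List.length-tabulate {n = n} id))

∑-allVecs-suc : ∀ p m (f : 𝔽 p (suc m) → ℚ) →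
  ∑ (allVecs p (suc m)) f ≡ ∑[ a ∈ allFin p ] ∑[ w ∈ allVecs p m ] f (a ∷ w)
∑-allVecs-suc p m f =
  trans (∑-concatMap _ (allFin p) f) (∑-cong (allFin p) (λ a → ∑-map (a ∷_) (allVecs p m) f))

𝟙-≟v-∷ : ∀ {p m} (a b : Fin p) (v w : 𝔽 p m) → 𝟙 ((a ∷ v) ≟v (b ∷ w)) ≡ 𝟙 (a Fin.≟ b) * 𝟙 (v ≟v w)
𝟙-≟v-∷ a b v w = trans (𝟙-cong ((a ∷ v) ≟v (b ∷ w)) (a Fin.≟ b ×-dec v ≟v w) ∷-≡⇔)
                       (𝟙-× (a Fin.≟ b) (v ≟v w))
  where
  ∷-≡⇔ : (a ∷ v ≡ b ∷ w) ⇔ (a ≡ b × v ≡ w)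
  ∷-≡⇔ = mk⇔ Vec.∷-injective λ { (refl , refl) → refl }

∑-allVecs-δ : ∀ p m (v : 𝔽 p m) (h : 𝔽 p m → ℚ) → ∑[ w ∈ allVecs p m ] (𝟙 (v ≟v w) * h w) ≡ h v
∑-allVecs-δ p zero    [] h = trans (+-identityʳ _) (*-identityˡ (h []))
∑-allVecs-δ p (suc m) (a ∷ v) h = begin
  ∑[ w ∈ allVecs p (suc m) ] (𝟙 ((a ∷ v) ≟v w) * h w)
    ≡⟨ ∑-allVecs-suc p m _ ⟩
  ∑[ b ∈ allFin p ] ∑[ w ∈ allVecs p m ] (𝟙 ((a ∷ v) ≟v (b ∷ w)) * h (b ∷ w))
    ≡⟨ ∑-cong (allFin p) inner ⟩
  ∑[ b ∈ allFin p ] (𝟙 (a Fin.≟ b) * h (b ∷ v))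
    ≡⟨ ∑-allFin-δ p a (λ b → h (b ∷ v)) ⟩
  h (a ∷ v) ∎
  where
  open ≡-Reasoning
  inner : ∀ b → ∑[ w ∈ allVecs p m ] (𝟙 ((a ∷ v) ≟v (b ∷ w)) * h (b ∷ w)) ≡ 𝟙 (a Fin.≟ b) * h (b ∷ v)
  inner b = begin
    ∑[ w ∈ allVecs p m ] (𝟙 ((a ∷ v) ≟v (b ∷ w)) * h (b ∷ w))   ≡⟨ ∑-cong (allVecs p m) split ⟩
    ∑[ w ∈ allVecs p m ] (a≡b * (𝟙 (v ≟v w) * h (b ∷ w)))       ≡⟨ ∑-*ˡ a≡b (allVecs p m) _ ⟩
    a≡b * ∑[ w ∈ allVecs p m ] (𝟙 (v ≟v w) * h (b ∷ w))         ≡⟨ cong (a≡b *_) (∑-allVecs-δ p m v _) ⟩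
    a≡b * h (b ∷ v)                                             ∎
    where
    a≡b = 𝟙 (a Fin.≟ b)
    split : ∀ w → 𝟙 ((a ∷ v) ≟v (b ∷ w)) * h (b ∷ w) ≡ a≡b * (𝟙 (v ≟v w) * h (b ∷ w))
    split w = trans (cong (_* h (b ∷ w)) (𝟙-≟v-∷ a b v w)) (*-assoc a≡b (𝟙 (v ≟v w)) (h (b ∷ w)))

∑-allVecs-const : ∀ p m c → ∑[ _ ∈ allVecs p m ] c ≡ pow p m * c
∑-allVecs-const p zero    c = trans (+-identityʳ c) (sym (*-identityˡ c))
∑-allVecs-const p (suc m) c = begin
  ∑[ _ ∈ allVecs p (suc m) ] c                  ≡⟨ ∑-allVecs-suc p m _ ⟩
  ∑[ _ ∈ allFin p ] ∑[ _ ∈ allVecs p m ] c      ≡⟨ ∑-cong (allFin p) (λ _ → ∑-allVecs-const p m c) ⟩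
  ∑[ _ ∈ allFin p ] (pow p m * c)               ≡⟨ ∑-allFin-const p (pow p m * c) ⟩
  fromℕ p * (pow p m * c)                       ≡⟨ *-assoc (fromℕ p) (pow p m) c ⟨
  fromℕ p * pow p m * c                         ≡⟨ cong (_* c) (fromℕ-* p (p ℕ.^ m)) ⟨
  pow p (suc m) * c                             ∎
  where open ≡-Reasoning

∑-allVecs-except : ∀ p m (v : 𝔽 p m) (h : 𝔽 p m → ℚ) →
  ∑ (filter (λ w → ¬? (w ≟v v)) (allVecs p m)) h ≡ ∑ (allVecs p m) h - h v
∑-allVecs-except p m v h = begin
  ∑ (filter (λ w → ¬? (w ≟v v)) vs) h
    ≡⟨ ∑-filter (λ w → ¬? (w ≟v v)) vs h ⟩
  ∑[ w ∈ vs ] (𝟙 (¬? (w ≟v v)) * h w)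
    ≡⟨ ∑-cong vs (λ w → trans (cong (_* h w) (𝟙-¬ (w ≟v v))) (complement (𝟙 (w ≟v v)) (h w))) ⟩
  ∑[ w ∈ vs ] (h w - 𝟙 (w ≟v v) * h w)
    ≡⟨ ∑-distrib-- vs h _ ⟩
  ∑ vs h - ∑[ w ∈ vs ] (𝟙 (w ≟v v) * h w)
    ≡⟨ cong (λ s → ∑ vs h - s) (∑-cong vs (λ w → cong (_* h w) (𝟙-≡-sym (w ≟v v) (v ≟v w)))) ⟩
  ∑ vs h - ∑[ w ∈ vs ] (𝟙 (v ≟v w) * h w)
    ≡⟨ cong (λ s → ∑ vs h - s) (∑-allVecs-δ p m v h) ⟩
  ∑ vs h - h v ∎
  where
  open ≡-Reasoning
  vs = allVecs p m
  complement : ∀ e x → (1ℚ - e) * x ≡ x - e * x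
  complement = solve-∀ ℚ-ring

∈-allVecs : ∀ {p m} (v : 𝔽 p m) → v ∈ allVecs p m
∈-allVecs []      = here refl
∈-allVecs (a ∷ v) = ∈-concatMap⁺ _ (Any.map (λ { refl → ∈-map⁺ (a ∷_) (∈-allVecs v) }) (∈-allFin a))

-- Cauchy–Schwarz

0≤q-p⇒p≤q : ∀ {p q} → 0ℚ ≤ q - p → p ≤ q
0≤q-p⇒p≤q {p} {q} 0≤q-p = begin
  p             ≡⟨ +-identityʳ p ⟨
  p + 0ℚ        ≤⟨ +-monoʳ-≤ p 0≤q-p ⟩
  p + (q - p)   ≡⟨ cancel p q ⟩
  q             ∎
  where
  open ≤-Reasoning
  cancel : ∀ p q → p + (q - p) ≡ q
  cancel = solve-∀ ℚ-ring

x*x-nonNeg : ∀ x → 0ℚ ≤ x * x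
x*x-nonNeg x with ≤-total 0ℚ x
... | inj₁ 0≤x = let instance _ = nonNegative 0≤x in nonNegative⁻¹ (x * x) {{nonNeg*nonNeg⇒nonNeg x x}}
... | inj₂ x≤0 = let instance _ = nonPositive x≤0 in nonNegative⁻¹ (x * x) {{nonPos*nonPos⇒nonPos x x}}

x*x≡0⇒x≡0 : ∀ x → x * x ≡ 0ℚ → x ≡ 0ℚ
x*x≡0⇒x≡0 x x*x≡0 with x ≟ 0ℚ
... | yes x≡0 = x≡0
... | no x≢0  = let instance _ = ≢-nonZero x≢0 in begin
  x                   ≡⟨ *-identityʳ x ⟨
  x * 1ℚ              ≡⟨ cong (x *_) (*-inverseʳ x) ⟨
  x * (x * 1/ x)      ≡⟨ *-assoc x x (1/ x) ⟨
  x * x * 1/ x        ≡⟨ cong (_* 1/ x) x*x≡0 ⟩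
  0ℚ * 1/ x           ≡⟨ *-zeroˡ (1/ x) ⟩
  0ℚ                  ∎
  where open ≡-Reasoning

-- |xs|² times the variance of f over xs.
dispersion : List A → (A → ℚ) → ℚ
dispersion xs f = (∑[ _ ∈ xs ] 1ℚ) * (∑[ x ∈ xs ] (f x * f x)) - ∑ xs f * ∑ xs f

∑-deviation² : ∀ (xs : List A) f → let K = ∑[ _ ∈ xs ] 1ℚ; S = ∑ xs f in
  ∑[ x ∈ xs ] ((K * f x - S) * (K * f x - S)) ≡ K * dispersion xs f
∑-deviation² xs f = begin
  ∑[ x ∈ xs ] ((K * f x - S) * (K * f x - S))
    ≡⟨ ∑-cong xs (λ x → expand K S (f x)) ⟩
  ∑[ x ∈ xs ] (K * K * (f x * f x) - (K + K) * S * f x + S * S * 1ℚ)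
    ≡⟨ ∑-distrib-+ xs _ _ ⟩
  ∑[ x ∈ xs ] (K * K * (f x * f x) - (K + K) * S * f x) + ∑[ _ ∈ xs ] (S * S * 1ℚ)
    ≡⟨ cong₂ _+_ (∑-distrib-- xs _ _) (∑-*ˡ (S * S) xs (λ _ → 1ℚ)) ⟩
  ∑[ x ∈ xs ] (K * K * (f x * f x)) - ∑[ x ∈ xs ] ((K + K) * S * f x) + S * S * K
    ≡⟨ cong₂ (λ a b → a - b + S * S * K) (∑-*ˡ (K * K) xs _) (∑-*ˡ ((K + K) * S) xs f) ⟩
  K * K * T - (K + K) * S * S + S * S * K
    ≡⟨ collect K S T ⟩
  K * (K * T - S * S) ∎
  where
  open ≡-Reasoning
  K = ∑[ _ ∈ xs ] 1ℚ
  S = ∑ xs f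
  T = ∑[ x ∈ xs ] (f x * f x)
  expand : ∀ K S y → (K * y - S) * (K * y - S) ≡ K * K * (y * y) - (K + K) * S * y + S * S * 1ℚ
  expand = solve-∀ ℚ-ring
  collect : ∀ K S T → K * K * T - (K + K) * S * S + S * S * K ≡ K * (K * T - S * S)
  collect = solve-∀ ℚ-ring

dispersion-nonNeg : ∀ (xs : List A) f → 0ℚ ≤ dispersion xs f
dispersion-nonNeg []       f = ≤-refl
dispersion-nonNeg (x ∷ xs) f = *-cancelˡ-≤-pos K {{K>0}} (begin
  K * 0ℚ                                              ≡⟨ *-zeroʳ K ⟩
  0ℚ                                                  ≤⟨ ∑-nonNeg (x ∷ xs) (λ y → x*x-nonNeg (K * f y - S)) ⟩
  ∑[ y ∈ x ∷ xs ] ((K * f y - S) * (K * f y - S))     ≡⟨ ∑-deviation² (x ∷ xs) f ⟩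
  K * dispersion (x ∷ xs) f                           ∎)
  where
  open ≤-Reasoning
  K = ∑[ _ ∈ x ∷ xs ] 1ℚ
  S = ∑ (x ∷ xs) f
  K>0 : Positive K
  K>0 = pos+nonNeg⇒pos 1ℚ (∑[ _ ∈ xs ] 1ℚ) {{nonNegative (∑-nonNeg xs (λ _ → nonNegative⁻¹ 1ℚ))}}

dispersion≡0⇒constant : ∀ {xs : List A} {f x} → dispersion xs f ≡ 0ℚ → x ∈ xs →
  (∑[ _ ∈ xs ] 1ℚ) * f x ≡ ∑ xs f
dispersion≡0⇒constant {xs = xs} {f} {x} D≡0 x∈xs =
  x∙y⁻¹≈ε⇒x≈y (K * f x) S (x*x≡0⇒x≡0 (K * f x - S) (≤-antisym deviation≤0 (x*x-nonNeg (K * f x - S))))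
  where
  K = ∑[ _ ∈ xs ] 1ℚ
  S = ∑ xs f
  deviation≤0 : (K * f x - S) * (K * f x - S) ≤ 0ℚ
  deviation≤0 = begin
    (K * f x - S) * (K * f x - S)                     ≤⟨ ∈⇒≤∑ (λ y → x*x-nonNeg (K * f y - S)) x∈xs ⟩
    ∑[ y ∈ xs ] ((K * f y - S) * (K * f y - S))       ≡⟨ ∑-deviation² xs f ⟩
    K * dispersion xs f                               ≡⟨ cong (K *_) D≡0 ⟩
    K * 0ℚ                                            ≡⟨ *-zeroʳ K ⟩
    0ℚ                                                ∎
    where open ≤-Reasoning

-- Character sums over 𝔽_p^m

module CharacterSums (p : ℕ) .{{_ : NonZero p}} (p-prime : Prime p) where
  private module M = Congruence p
  open M using (_≈_; _≈?_)

  0≉1 : ¬ 0 ≈ 1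
  0≉1 = M.1<p⇒0≉1 (ℕ.nonTrivial⇒n>1 p {{prime⇒nonTrivial p-prime}})

  ∑-affine-solutions : ∀ {g d : Fin p} → g ≢ d → ∀ s t →
    ∑[ a ∈ allFin p ] 𝟙 (s ℕ.+ toℕ a ℕ.* toℕ g ≈? t ℕ.+ toℕ a ℕ.* toℕ d) ≡ 1ℚ
  ∑-affine-solutions g≢d s t = ∑-allFin-unique _ (M.affine-solution p-prime g≢d s t)

  solutionCount : ∀ {m} → 𝔽 p m → 𝔽 p m → ℕ → ℕ → ℚ
  solutionCount {m} γ δ s t = ∑[ b ∈ allVecs p m ] 𝟙 (s ℕ.+ dotℕ b γ ≈? t ℕ.+ dotℕ b δ)

  solutionCount-∷ : ∀ {m} (g d : Fin p) (γ δ : 𝔽 p m) s t → solutionCount (g ∷ γ) (d ∷ δ) s t ≡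
    ∑[ a ∈ allFin p ] solutionCount γ δ (s ℕ.+ toℕ a ℕ.* toℕ g) (t ℕ.+ toℕ a ℕ.* toℕ d)
  solutionCount-∷ {m} g d γ δ s t =
    trans (∑-allVecs-suc p m _) (∑-cong (allFin p) λ a → ∑-cong (allVecs p m) λ w →
      cong₂ (λ x y → 𝟙 (x ≈? y)) (sym (ℕP.+-assoc s _ (dotℕ w γ))) (sym (ℕP.+-assoc t _ (dotℕ w δ))))

  solutionCount-diagonal : ∀ {m} (γ : 𝔽 p m) s t → solutionCount γ γ s t ≡ pow p m * 𝟙 (s ≈? t)
  solutionCount-diagonal {m} γ s t = trans (∑-cong (allVecs p m) cancel) (∑-allVecs-const p m (𝟙 (s ≈? t)))
    where
    cancel : ∀ b → 𝟙 (s ℕ.+ dotℕ b γ ≈? t ℕ.+ dotℕ b γ) ≡ 𝟙 (s ≈? t)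
    cancel b = 𝟙-cong _ (s ≈? t) (mk⇔ M.+-cancelʳ (λ s≈t → M.+-cong s≈t M.≈-refl))

  -- A nonzero linear form on 𝔽_p^m takes each value p^(m-1) times.
  solutionCount-offDiagonal : ∀ {m} {γ δ : 𝔽 p m} → γ ≢ δ → ∀ s t →
    fromℕ p * solutionCount γ δ s t ≡ pow p m
  solutionCount-offDiagonal {zero} {[]} {[]} []≢[] = ⊥-elim ([]≢[] refl)
  solutionCount-offDiagonal {suc m} {g ∷ γ} {d ∷ δ} gγ≢dδ s t with γ ≟v δ
  ... | yes refl = begin
    fromℕ p * solutionCount (g ∷ γ) (d ∷ γ) s t
      ≡⟨ cong (fromℕ p *_) (solutionCount-∷ g d γ γ s t) ⟩
    fromℕ p * ∑[ a ∈ allFin p ] solutionCount γ γ (s′ a) (t′ a)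
      ≡⟨ cong (fromℕ p *_) (∑-cong (allFin p) λ a → solutionCount-diagonal γ (s′ a) (t′ a)) ⟩
    fromℕ p * ∑[ a ∈ allFin p ] (pow p m * 𝟙 (s′ a ≈? t′ a))
      ≡⟨ cong (fromℕ p *_) (∑-*ˡ (pow p m) (allFin p) _) ⟩
    fromℕ p * (pow p m * ∑[ a ∈ allFin p ] 𝟙 (s′ a ≈? t′ a))
      ≡⟨ cong (λ c → fromℕ p * (pow p m * c)) (∑-affine-solutions g≢d s t) ⟩
    fromℕ p * (pow p m * 1ℚ)
      ≡⟨ cong (fromℕ p *_) (*-identityʳ (pow p m)) ⟩
    fromℕ p * pow p m
      ≡⟨ fromℕ-* p (p ℕ.^ m) ⟨
    pow p (suc m) ∎
    where
    open ≡-Reasoning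
    s′ t′ : Fin p → ℕ
    s′ a = s ℕ.+ toℕ a ℕ.* toℕ g
    t′ a = t ℕ.+ toℕ a ℕ.* toℕ d
    g≢d : g ≢ d
    g≢d refl = gγ≢dδ refl
  ... | no γ≢δ = begin
    fromℕ p * solutionCount (g ∷ γ) (d ∷ δ) s t
      ≡⟨ cong (fromℕ p *_) (solutionCount-∷ g d γ δ s t) ⟩
    fromℕ p * ∑[ a ∈ allFin p ] solutionCount γ δ (s′ a) (t′ a)
      ≡⟨ ∑-*ˡ (fromℕ p) (allFin p) _ ⟨
    ∑[ a ∈ allFin p ] (fromℕ p * solutionCount γ δ (s′ a) (t′ a))
      ≡⟨ ∑-cong (allFin p) (λ a → solutionCount-offDiagonal γ≢δ (s′ a) (t′ a)) ⟩
    ∑[ _ ∈ allFin p ] pow p m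
      ≡⟨ ∑-allFin-const p (pow p m) ⟩
    fromℕ p * pow p m
      ≡⟨ fromℕ-* p (p ℕ.^ m) ⟨
    pow p (suc m) ∎
    where
    open ≡-Reasoning
    s′ t′ : Fin p → ℕ
    s′ a = s ℕ.+ toℕ a ℕ.* toℕ g
    t′ a = t ℕ.+ toℕ a ℕ.* toℕ d

  -- Orthogonality of the additive characters of 𝔽_p^m, read off at the coefficients ζ⁰ and ζ¹.
  orthogonality : ∀ {m} (γ δ : 𝔽 p m) →
    ∑[ b ∈ allVecs p m ] (𝟙 (dotℕ b γ ≈? dotℕ b δ) - 𝟙 (dotℕ b γ ≈? suc (dotℕ b δ)))
      ≡ pow p m * 𝟙 (γ ≟v δ)
  orthogonality {m} γ δ = trans (∑-distrib-- (allVecs p m) _ _) (by-cases γ δ)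
    where
    by-cases : ∀ γ δ → solutionCount γ δ 0 0 - solutionCount γ δ 0 1 ≡ pow p m * 𝟙 (γ ≟v δ)
    by-cases γ δ with γ ≟v δ
    ... | yes refl = begin
      solutionCount γ γ 0 0 - solutionCount γ γ 0 1
        ≡⟨ cong₂ _-_ (solutionCount-diagonal γ 0 0) (solutionCount-diagonal γ 0 1) ⟩
      pow p m * 𝟙 (0 ≈? 0) - pow p m * 𝟙 (0 ≈? 1)
        ≡⟨ cong₂ (λ a b → pow p m * a - pow p m * b) (𝟙-yes (0 ≈? 0) M.≈-refl) (𝟙-no (0 ≈? 1) 0≉1) ⟩
      pow p m * 1ℚ - pow p m * 0ℚ
        ≡⟨ cong (λ z → pow p m * 1ℚ - z) (*-zeroʳ (pow p m)) ⟩
      pow p m * 1ℚ - 0ℚ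
        ≡⟨ +-identityʳ (pow p m * 1ℚ) ⟩
      pow p m * 1ℚ ∎
      where open ≡-Reasoning
    ... | no γ≢δ = begin
      solutionCount γ δ 0 0 - solutionCount γ δ 0 1        ≡⟨ cong (_- solutionCount γ δ 0 1) equal ⟩
      solutionCount γ δ 0 1 - solutionCount γ δ 0 1        ≡⟨ +-inverseʳ (solutionCount γ δ 0 1) ⟩
      0ℚ                                                   ≡⟨ *-zeroʳ (pow p m) ⟨
      pow p m * 0ℚ                                         ∎
      where
      open ≡-Reasoning
      equal : solutionCount γ δ 0 0 ≡ solutionCount γ δ 0 1
      equal = fromℕ-*-cancelˡ p (trans (solutionCount-offDiagonal γ≢δ 0 0)
                                       (sym (solutionCount-offDiagonal γ≢δ 0 1)))

-- The imbalance as a collision count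

∑-fibre-products : ∀ {p} (xs : List A) (c : A → Fin p) (σ : Fin p → Fin p) →
  ∑[ i ∈ allFin p ] ((∑[ x ∈ xs ] 𝟙 (i Fin.≟ c x)) * (∑[ y ∈ xs ] 𝟙 (σ i Fin.≟ c y)))
    ≡ ∑[ x ∈ xs ] ∑[ y ∈ xs ] 𝟙 (σ (c x) Fin.≟ c y)
∑-fibre-products {p = p} xs c σ = begin
  ∑[ i ∈ allFin p ] ((∑[ x ∈ xs ] 𝟙 (i Fin.≟ c x)) * fibre (σ i))
    ≡⟨ ∑-cong (allFin p) (λ i → ∑-*ʳ (fibre (σ i)) xs _) ⟨
  ∑[ i ∈ allFin p ] ∑[ x ∈ xs ] (𝟙 (i Fin.≟ c x) * fibre (σ i))
    ≡⟨ ∑-comm (allFin p) xs _ ⟩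
  ∑[ x ∈ xs ] ∑[ i ∈ allFin p ] (𝟙 (i Fin.≟ c x) * fibre (σ i))
    ≡⟨ ∑-cong xs (λ x → ∑-cong (allFin p) λ i → cong (_* fibre (σ i)) (𝟙-≡-sym (i Fin.≟ c x) (c x Fin.≟ i))) ⟩
  ∑[ x ∈ xs ] ∑[ i ∈ allFin p ] (𝟙 (c x Fin.≟ i) * fibre (σ i))
    ≡⟨ ∑-cong xs (λ x → ∑-allFin-δ p (c x) (fibre ∘ σ)) ⟩
  ∑[ x ∈ xs ] fibre (σ (c x)) ∎
  where
  open ≡-Reasoning
  fibre : Fin _ → ℚ
  fibre k = ∑[ y ∈ xs ] 𝟙 (k Fin.≟ c y)

embed-coefficients : ∀ {p} .{{_ : NonZero p}} {a : Cyc p} {N : ℚ} {i : Fin p} →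
  i ≢ 0 mod p → a ≈ᶜ embed N → N ≡ a (0 mod p) - a i
embed-coefficients {p} {a} {N} {i} i≢0 (c , a-N≡c) = begin
  N                               ≡⟨ isolate (a (0 mod p)) N ⟩
  a (0 mod p) - (a (0 mod p) - N * 1ℚ)   ≡⟨ cong (λ z → a (0 mod p) - z) (trans at-0 (sym at-i)) ⟩
  a (0 mod p) - (a i - N * 0ℚ)    ≡⟨ drop (a (0 mod p)) (a i) N ⟩
  a (0 mod p) - a i               ∎
  where
  open ≡-Reasoning
  at-0 : a (0 mod p) - N * 1ℚ ≡ c
  at-0 = trans (cong (λ z → a (0 mod p) - N * z) (sym (𝟙-yes ((0 mod p) Fin.≟ (0 mod p)) refl))) (a-N≡c (0 mod p))
  at-i : a i - N * 0ℚ ≡ c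
  at-i = trans (cong (λ z → a i - N * z) (sym (𝟙-no (i Fin.≟ (0 mod p)) i≢0))) (a-N≡c i)
  isolate : ∀ a N → N ≡ a - (a - N * 1ℚ)
  isolate = solve-∀ ℚ-ring
  drop : ∀ a b N → a - (b - N * 0ℚ) ≡ a - b
  drop = solve-∀ ℚ-ring

module WalshCoefficients (p : ℕ) .{{_ : NonZero p}} {n m : ℕ} (F : 𝔽 p n → 𝔽 p m) where
  private module M = Congruence p
  open M using (_≈_; _≈?_)

  pairCount : ℕ → 𝔽 p m → ℚ
  pairCount r b = ∑[ x ∈ allVecs p n ] ∑[ y ∈ allVecs p n ] 𝟙 (dotℕ b (F x) ≈? r ℕ.+ dotℕ b (F y))

  pairCount-cong : ∀ {r r′} → r ≈ r′ → ∀ b → pairCount r b ≡ pairCount r′ b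
  pairCount-cong r≈r′ b = ∑-cong (allVecs p n) λ x → ∑-cong (allVecs p n) λ y →
    𝟙-cong (_ ≈? _) (_ ≈? _) (M.≈-resp-⇔ M.≈-refl (M.+-cong r≈r′ M.≈-refl))

  absSq-walsh-coefficient : ∀ b j → absSqᶜ (walsh F b zeroVec) j ≡ pairCount (toℕ j) b
  absSq-walsh-coefficient b j = begin
    absSqᶜ (walsh F b zeroVec) j
      ≡⟨ sumℚ-map _ (allFin p) ⟩
    ∑[ i ∈ allFin p ] (walsh F b zeroVec i * walsh F b zeroVec (σ i))
      ≡⟨ ∑-cong (allFin p) (λ i → cong₂ _*_ (coefficient i) (coefficient (σ i))) ⟩
    ∑[ i ∈ allFin p ] ((∑[ x ∈ X ] 𝟙 (i Fin.≟ e x)) * (∑[ y ∈ X ] 𝟙 (σ i Fin.≟ e y)))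
                                                                             ≡⟨ ∑-fibre-products X e σ ⟩
    ∑[ x ∈ X ] ∑[ y ∈ X ] 𝟙 (σ (e x) Fin.≟ e y)
      ≡⟨ ∑-cong X (λ x → ∑-cong X λ y → 𝟙-cong _ _ (exponents x y)) ⟩
    pairCount (toℕ j) b ∎
    where
    open ≡-Reasoning
    X = allVecs p n
    e : 𝔽 p n → Fin p
    e x = ⟨ b , F x ⟩ ⊖ ⟨ zeroVec , x ⟩
    σ : Fin p → Fin p
    σ i = (0 mod p) ⊖ (j ⊖ i)
    coefficient : ∀ i → walsh F b zeroVec i ≡ ∑[ x ∈ X ] 𝟙 (i Fin.≟ e x)
    coefficient = sumᶜ-coefficient (ζ^ ∘ e) X
    exponents : ∀ x y → (σ (e x) ≡ e y) ⇔ (dotℕ b (F x) ≈ toℕ j ℕ.+ dotℕ b (F y))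
    exponents x y = ⇔-trans (M.0⊖[j⊖i]≡k⇔i≈j+k (e x) j (e y))
      (M.≈-resp-⇔ (M.toℕ-⟨b,y⟩⊖⟨0,x⟩ b (F x) x) (M.+-cong (M.≈-refl {toℕ j}) (M.toℕ-⟨b,y⟩⊖⟨0,x⟩ b (F y) y)))

  imbalance-coefficient : ∀ j → imbalance F j ≡
    invPow p m * ∑ (filter (λ b → ¬? (b ≟v zeroVec)) (allVecs p m)) (pairCount (toℕ j))
  imbalance-coefficient j = cong (invPow p m *_) (begin
    sumᶜ (map (λ b → absSqᶜ (walsh F b zeroVec)) nonzero) j   ≡⟨ sumᶜ-coefficient _ nonzero j ⟩
    ∑[ b ∈ nonzero ] absSqᶜ (walsh F b zeroVec) j             ≡⟨ ∑-cong nonzero (λ b → absSq-walsh-coefficient b j) ⟩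
    ∑ nonzero (pairCount (toℕ j))                            ∎)
    where
    open ≡-Reasoning
    nonzero = filter (λ b → ¬? (b ≟v zeroVec)) (allVecs p m)

module Imbalance (p : ℕ) .{{_ : NonZero p}} (p-prime : Prime p) {n m : ℕ} (F : 𝔽 p n → 𝔽 p m) where
  open WalshCoefficients p F
  open CharacterSums p p-prime using (orthogonality; 0≉1)
  private module M = Congruence p
  open M using (_≈?_)

  private
    𝔽ⁿ = allVecs p n
    𝔽ᵐ = allVecs p m
    pⁿ = pow p n
    pᵐ = pow p m
    p⁻ᵐ = invPow p m

  fibre : 𝔽 p m → ℚ
  fibre β = fromℕ (preimageSize F β)

  fibre≡∑ : ∀ β → fibre β ≡ ∑[ x ∈ 𝔽ⁿ ] 𝟙 (F x ≟v β)
  fibre≡∑ β = length-filter (λ x → F x ≟v β) 𝔽ⁿ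

  ∑-fibre : ∑[ β ∈ 𝔽ᵐ ] fibre β ≡ pⁿ
  ∑-fibre = begin
    ∑[ β ∈ 𝔽ᵐ ] fibre β
      ≡⟨ ∑-cong 𝔽ᵐ fibre≡∑ ⟩
    ∑[ β ∈ 𝔽ᵐ ] ∑[ x ∈ 𝔽ⁿ ] 𝟙 (F x ≟v β)
      ≡⟨ ∑-comm 𝔽ᵐ 𝔽ⁿ _ ⟩
    ∑[ x ∈ 𝔽ⁿ ] ∑[ β ∈ 𝔽ᵐ ] 𝟙 (F x ≟v β)
      ≡⟨ ∑-cong 𝔽ⁿ (λ x → ∑-cong 𝔽ᵐ λ β → sym (*-identityʳ _)) ⟩
    ∑[ x ∈ 𝔽ⁿ ] ∑[ β ∈ 𝔽ᵐ ] (𝟙 (F x ≟v β) * 1ℚ)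
      ≡⟨ ∑-cong 𝔽ⁿ (λ x → ∑-allVecs-δ p m (F x) (λ _ → 1ℚ)) ⟩
    ∑[ _ ∈ 𝔽ⁿ ] 1ℚ
      ≡⟨ ∑-allVecs-const p n 1ℚ ⟩
    pⁿ * 1ℚ
      ≡⟨ *-identityʳ pⁿ ⟩
    pⁿ ∎
    where open ≡-Reasoning

  collisions : ℚ
  collisions = ∑[ x ∈ 𝔽ⁿ ] ∑[ y ∈ 𝔽ⁿ ] 𝟙 (F x ≟v F y)

  collisions≡∑fibre² : collisions ≡ ∑[ β ∈ 𝔽ᵐ ] (fibre β * fibre β)
  collisions≡∑fibre² = begin
    ∑[ x ∈ 𝔽ⁿ ] ∑[ y ∈ 𝔽ⁿ ] 𝟙 (F x ≟v F y)
      ≡⟨ ∑-cong 𝔽ⁿ (λ x → ∑-cong 𝔽ⁿ λ y → 𝟙-≡-sym (F x ≟v F y) (F y ≟v F x)) ⟩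
    ∑[ x ∈ 𝔽ⁿ ] ∑[ y ∈ 𝔽ⁿ ] 𝟙 (F y ≟v F x)
      ≡⟨ ∑-cong 𝔽ⁿ (λ x → fibre≡∑ (F x)) ⟨
    ∑[ x ∈ 𝔽ⁿ ] fibre (F x)
      ≡⟨ ∑-cong 𝔽ⁿ (λ x → ∑-allVecs-δ p m (F x) fibre) ⟨
    ∑[ x ∈ 𝔽ⁿ ] ∑[ β ∈ 𝔽ᵐ ] (𝟙 (F x ≟v β) * fibre β)
      ≡⟨ ∑-comm 𝔽ⁿ 𝔽ᵐ _ ⟩
    ∑[ β ∈ 𝔽ᵐ ] ∑[ x ∈ 𝔽ⁿ ] (𝟙 (F x ≟v β) * fibre β)
      ≡⟨ ∑-cong 𝔽ᵐ (λ β → ∑-*ʳ (fibre β) 𝔽ⁿ _) ⟩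
    ∑[ β ∈ 𝔽ᵐ ] ((∑[ x ∈ 𝔽ⁿ ] 𝟙 (F x ≟v β)) * fibre β)
      ≡⟨ ∑-cong 𝔽ᵐ (λ β → cong (_* fibre β) (fibre≡∑ β)) ⟨
    ∑[ β ∈ 𝔽ᵐ ] (fibre β * fibre β) ∎
    where open ≡-Reasoning

  ∑-pairCount-difference : ∑[ b ∈ 𝔽ᵐ ] (pairCount 0 b - pairCount 1 b) ≡ pᵐ * collisions
  ∑-pairCount-difference = begin
    ∑[ b ∈ 𝔽ᵐ ] (pairCount 0 b - pairCount 1 b)
      ≡⟨ ∑-cong 𝔽ᵐ (λ b → sym (pointwise b)) ⟩
    ∑[ b ∈ 𝔽ᵐ ] ∑[ x ∈ 𝔽ⁿ ] ∑[ y ∈ 𝔽ⁿ ] character b x y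
      ≡⟨ ∑-comm 𝔽ᵐ 𝔽ⁿ _ ⟩
    ∑[ x ∈ 𝔽ⁿ ] ∑[ b ∈ 𝔽ᵐ ] ∑[ y ∈ 𝔽ⁿ ] character b x y
      ≡⟨ ∑-cong 𝔽ⁿ (λ x → ∑-comm 𝔽ᵐ 𝔽ⁿ _) ⟩
    ∑[ x ∈ 𝔽ⁿ ] ∑[ y ∈ 𝔽ⁿ ] ∑[ b ∈ 𝔽ᵐ ] character b x y
      ≡⟨ ∑-cong 𝔽ⁿ (λ x → ∑-cong 𝔽ⁿ λ y → orthogonality (F x) (F y)) ⟩
    ∑[ x ∈ 𝔽ⁿ ] ∑[ y ∈ 𝔽ⁿ ] (pᵐ * 𝟙 (F x ≟v F y))
      ≡⟨ ∑-cong 𝔽ⁿ (λ x → ∑-*ˡ pᵐ 𝔽ⁿ _) ⟩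
    ∑[ x ∈ 𝔽ⁿ ] (pᵐ * ∑[ y ∈ 𝔽ⁿ ] 𝟙 (F x ≟v F y))
      ≡⟨ ∑-*ˡ pᵐ 𝔽ⁿ _ ⟩
    pᵐ * collisions ∎
    where
    open ≡-Reasoning
    character : 𝔽 p m → 𝔽 p n → 𝔽 p n → ℚ
    character b x y = 𝟙 (dotℕ b (F x) ≈? dotℕ b (F y)) - 𝟙 (dotℕ b (F x) ≈? suc (dotℕ b (F y)))
    pointwise : ∀ b → ∑[ x ∈ 𝔽ⁿ ] ∑[ y ∈ 𝔽ⁿ ] character b x y ≡ pairCount 0 b - pairCount 1 b
    pointwise b = trans (∑-cong 𝔽ⁿ (λ x → ∑-distrib-- 𝔽ⁿ _ _)) (∑-distrib-- 𝔽ⁿ _ _)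

  pairCount-zeroVec : ∀ r → pairCount r zeroVec ≡ pⁿ * (pⁿ * 𝟙 (0 ≈? r))
  pairCount-zeroVec r = begin
    pairCount r zeroVec                       ≡⟨ ∑-cong 𝔽ⁿ (λ x → ∑-cong 𝔽ⁿ λ y → 𝟙-cong (_ ≈? _) (0 ≈? r) (⇔0≈r x y)) ⟩
    ∑[ _ ∈ 𝔽ⁿ ] ∑[ _ ∈ 𝔽ⁿ ] 𝟙 (0 ≈? r)        ≡⟨ ∑-cong 𝔽ⁿ (λ _ → ∑-allVecs-const p n (𝟙 (0 ≈? r))) ⟩
    ∑[ _ ∈ 𝔽ⁿ ] (pⁿ * 𝟙 (0 ≈? r))             ≡⟨ ∑-allVecs-const p n (pⁿ * 𝟙 (0 ≈? r)) ⟩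
    pⁿ * (pⁿ * 𝟙 (0 ≈? r))                    ∎
    where
    open ≡-Reasoning
    ⟨0,F⟩≈0 : ∀ x → dotℕ zeroVec (F x) M.≈ 0
    ⟨0,F⟩≈0 x = M.dotℕ-zeroVecˡ (F x)
    ⇔0≈r : ∀ x y → (dotℕ zeroVec (F x) M.≈ r ℕ.+ dotℕ zeroVec (F y)) ⇔ (0 M.≈ r)
    ⇔0≈r x y = M.≈-resp-⇔ (⟨0,F⟩≈0 x) (M.≈-trans (M.+-cong (M.≈-refl {r}) (⟨0,F⟩≈0 y))
                                                  (M.≈-reflexive (ℕP.+-identityʳ r)))

  pairCount-difference-zeroVec : pairCount 0 zeroVec - pairCount 1 zeroVec ≡ pⁿ * pⁿ
  pairCount-difference-zeroVec = begin
    pairCount 0 zeroVec - pairCount 1 zeroVec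
      ≡⟨ cong₂ _-_ (pairCount-zeroVec 0) (pairCount-zeroVec 1) ⟩
    pⁿ * (pⁿ * 𝟙 (0 ≈? 0)) - pⁿ * (pⁿ * 𝟙 (0 ≈? 1))
      ≡⟨ cong₂ (λ a b → pⁿ * (pⁿ * a) - pⁿ * (pⁿ * b)) (𝟙-yes (0 ≈? 0) M.≈-refl) (𝟙-no (0 ≈? 1) 0≉1) ⟩
    pⁿ * (pⁿ * 1ℚ) - pⁿ * (pⁿ * 0ℚ)
      ≡⟨ simplify pⁿ ⟩
    pⁿ * pⁿ ∎
    where
    open ≡-Reasoning
    simplify : ∀ P → P * (P * 1ℚ) - P * (P * 0ℚ) ≡ P * P
    simplify = solve-∀ ℚ-ring

  ∑-nonzero-pairCount-difference : ∑[ b ∈ filter (λ b → ¬? (b ≟v zeroVec)) 𝔽ᵐ ] (pairCount 0 b - pairCount 1 b)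
                                     ≡ pᵐ * collisions - pⁿ * pⁿ
  ∑-nonzero-pairCount-difference =
    trans (∑-allVecs-except p m zeroVec _) (cong₂ _-_ ∑-pairCount-difference pairCount-difference-zeroVec)

  imbalance-formula : ∀ N → imbalance F ≈ᶜ embed N →
    N ≡ ∑[ β ∈ 𝔽ᵐ ] (fibre β * fibre β) - p⁻ᵐ * (pⁿ * pⁿ)
  imbalance-formula N imbalance≈N = begin
    N
      ≡⟨ embed-coefficients {a = imbalance F} (M.≉⇒mod-≢ (0≉1 ∘ M.≈-sym)) imbalance≈N ⟩
    imbalance F (0 mod p) - imbalance F (1 mod p)
      ≡⟨ cong₂ _-_ (imbalance-coefficient (0 mod p)) (imbalance-coefficient (1 mod p)) ⟩
    p⁻ᵐ * ∑ nonzero (pairCount (toℕ (0 mod p))) - p⁻ᵐ * ∑ nonzero (pairCount (toℕ (1 mod p)))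
      ≡⟨ cong₂ (λ a b → p⁻ᵐ * a - p⁻ᵐ * b) (reduce 0) (reduce 1) ⟩
    p⁻ᵐ * ∑ nonzero (pairCount 0) - p⁻ᵐ * ∑ nonzero (pairCount 1)
      ≡⟨ factor p⁻ᵐ _ _ ⟩
    p⁻ᵐ * (∑ nonzero (pairCount 0) - ∑ nonzero (pairCount 1))
      ≡⟨ cong (p⁻ᵐ *_) (∑-distrib-- nonzero _ _) ⟨
    p⁻ᵐ * ∑[ b ∈ nonzero ] (pairCount 0 b - pairCount 1 b)
      ≡⟨ cong (p⁻ᵐ *_) ∑-nonzero-pairCount-difference ⟩
    p⁻ᵐ * (pᵐ * collisions - pⁿ * pⁿ)
      ≡⟨ distribute p⁻ᵐ pᵐ collisions (pⁿ * pⁿ) ⟩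
    p⁻ᵐ * pᵐ * collisions - p⁻ᵐ * (pⁿ * pⁿ)
      ≡⟨ cong (λ z → z * collisions - p⁻ᵐ * (pⁿ * pⁿ)) (invPow*pow≡1 p m) ⟩
    1ℚ * collisions - p⁻ᵐ * (pⁿ * pⁿ)
      ≡⟨ cong (λ z → z - p⁻ᵐ * (pⁿ * pⁿ)) (trans (*-identityˡ collisions) collisions≡∑fibre²) ⟩
    ∑[ β ∈ 𝔽ᵐ ] (fibre β * fibre β) - p⁻ᵐ * (pⁿ * pⁿ) ∎
    where
    open ≡-Reasoning
    nonzero = filter (λ b → ¬? (b ≟v zeroVec)) 𝔽ᵐ
    reduce : ∀ k → ∑ nonzero (pairCount (toℕ (k mod p))) ≡ ∑ nonzero (pairCount k)
    reduce k = ∑-cong nonzero (pairCount-cong (M.toℕ-mod k))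

    factor : ∀ u a b → u * a - u * b ≡ u * (a - b)
    factor = solve-∀ ℚ-ring
    distribute : ∀ u q c r → u * (q * c - r) ≡ u * q * c - u * r
    distribute = solve-∀ ℚ-ring

module PreimageBound (p : ℕ) .{{_ : NonZero p}} (p-prime : Prime p) {n m : ℕ} (F : 𝔽 p n → 𝔽 p m)
                     (N : ℚ) (imbalance≈N : imbalance F ≈ᶜ embed N) (β : 𝔽 p m) where
  open Imbalance p p-prime F

  private
    pⁿ = pow p n
    pᵐ = pow p m
    p⁻ᵐ = invPow p m
    fibre² : 𝔽 p m → ℚ
    fibre² α = fibre α * fibre α
    others = filter (λ α → ¬? (α ≟v β)) (allVecs p m)

  others-count : ∑[ _ ∈ others ] 1ℚ ≡ pᵐ - 1ℚ
  others-count = begin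
    ∑[ _ ∈ others ] 1ℚ            ≡⟨ ∑-allVecs-except p m β (λ _ → 1ℚ) ⟩
    ∑[ _ ∈ allVecs p m ] 1ℚ - 1ℚ  ≡⟨ cong (_- 1ℚ) (∑-allVecs-const p m 1ℚ) ⟩
    pᵐ * 1ℚ - 1ℚ                  ≡⟨ cong (_- 1ℚ) (*-identityʳ pᵐ) ⟩
    pᵐ - 1ℚ                       ∎
    where open ≡-Reasoning

  dispersion-others : dispersion others fibre ≡
    (pᵐ - 1ℚ) * (∑ (allVecs p m) fibre² - fibre² β) - (pⁿ - fibre β) * (pⁿ - fibre β)
  dispersion-others = cong₂ (λ a b → a - b * b)
    (cong₂ _*_ others-count (∑-allVecs-except p m β fibre²))
    (trans (∑-allVecs-except p m β fibre) (cong (_- fibre β) ∑-fibre))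

  gap≡dispersion : (1ℚ - p⁻ᵐ) * N - (fibre β - pⁿ * p⁻ᵐ) * (fibre β - pⁿ * p⁻ᵐ)
                   ≡ p⁻ᵐ * dispersion others fibre
  gap≡dispersion = begin
    (1ℚ - p⁻ᵐ) * N - (fibre β - pⁿ * p⁻ᵐ) * (fibre β - pⁿ * p⁻ᵐ)
      ≡⟨ cong (λ z → (1ℚ - p⁻ᵐ) * z - deviation²) (imbalance-formula N imbalance≈N) ⟩
    (1ℚ - p⁻ᵐ) * (C - p⁻ᵐ * (pⁿ * pⁿ)) - deviation²
      ≡⟨ regroup p⁻ᵐ pᵐ pⁿ (fibre β) C ⟩
    p⁻ᵐ * Δ + (C - fibre² β) * (1ℚ - p⁻ᵐ * pᵐ)
      ≡⟨ cong (λ z → p⁻ᵐ * Δ + (C - fibre² β) * (1ℚ - z)) (invPow*pow≡1 p m) ⟩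
    p⁻ᵐ * Δ + (C - fibre² β) * (1ℚ - 1ℚ)
      ≡⟨ vanish (p⁻ᵐ * Δ) (C - fibre² β) ⟩
    p⁻ᵐ * Δ
      ≡⟨ cong (p⁻ᵐ *_) dispersion-others ⟨
    p⁻ᵐ * dispersion others fibre ∎
    where
    open ≡-Reasoning
    deviation² = (fibre β - pⁿ * p⁻ᵐ) * (fibre β - pⁿ * p⁻ᵐ)
    C = ∑ (allVecs p m) fibre²
    Δ = (pᵐ - 1ℚ) * (C - fibre² β) - (pⁿ - fibre β) * (pⁿ - fibre β)
    regroup : ∀ u q P y C → (1ℚ - u) * (C - u * (P * P)) - (y - P * u) * (y - P * u)
                            ≡ u * ((q - 1ℚ) * (C - y * y) - (P - y) * (P - y)) + (C - y * y) * (1ℚ - u * q)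
    regroup = solve-∀ ℚ-ring
    vanish : ∀ a t → a + t * (1ℚ - 1ℚ) ≡ a
    vanish = solve-∀ ℚ-ring

  preimage-bound : (fibre β - pⁿ * p⁻ᵐ) * (fibre β - pⁿ * p⁻ᵐ) ≤ (1ℚ - p⁻ᵐ) * N
  preimage-bound = 0≤q-p⇒p≤q (begin
    0ℚ                                ≤⟨ nonNegative⁻¹ (p⁻ᵐ * D) {{nonNeg*nonNeg⇒nonNeg p⁻ᵐ {{p⁻ᵐ≥0}} D {{D≥0}}}} ⟩
    p⁻ᵐ * D                           ≡⟨ gap≡dispersion ⟨
    (1ℚ - p⁻ᵐ) * N - (fibre β - pⁿ * p⁻ᵐ) * (fibre β - pⁿ * p⁻ᵐ) ∎)
    where
    open ≤-Reasoning
    D = dispersion others fibre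
    p⁻ᵐ≥0 : NonNegative p⁻ᵐ
    p⁻ᵐ≥0 = normalize-nonNeg 1 (p ℕ.^ m) {{ℕP.m^n≢0 p m}}
    D≥0 : NonNegative D
    D≥0 = nonNegative (dispersion-nonNeg others fibre)

  preimage-equality : (fibre β - pⁿ * p⁻ᵐ) * (fibre β - pⁿ * p⁻ᵐ) ≡ (1ℚ - p⁻ᵐ) * N →
    ∀ α → α ≢ β → fibre α * (pᵐ - 1ℚ) ≡ pⁿ - fibre β
  preimage-equality tight α α≢β = begin
    fibre α * (pᵐ - 1ℚ)
      ≡⟨ *-comm (fibre α) _ ⟩
    (pᵐ - 1ℚ) * fibre α
      ≡⟨ cong (_* fibre α) others-count ⟨
    (∑[ _ ∈ others ] 1ℚ) * fibre α
      ≡⟨ dispersion≡0⇒constant dispersion≡0 (∈-filter⁺ (λ α → ¬? (α ≟v β)) (∈-allVecs α) α≢β) ⟩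
    ∑ others fibre
      ≡⟨ trans (∑-allVecs-except p m β fibre) (cong (_- fibre β) ∑-fibre) ⟩
    pⁿ - fibre β ∎
    where
    open ≡-Reasoning
    D = dispersion others fibre
    p⁻ᵐD≡0 : p⁻ᵐ * D ≡ 0ℚ
    p⁻ᵐD≡0 = begin
      p⁻ᵐ * D                                                        ≡⟨ gap≡dispersion ⟨
      (1ℚ - p⁻ᵐ) * N - (fibre β - pⁿ * p⁻ᵐ) * (fibre β - pⁿ * p⁻ᵐ)  ≡⟨ cong (λ z → (1ℚ - p⁻ᵐ) * N - z) tight ⟩
      (1ℚ - p⁻ᵐ) * N - (1ℚ - p⁻ᵐ) * N                              ≡⟨ +-inverseʳ ((1ℚ - p⁻ᵐ) * N) ⟩
      0ℚ                                                             ∎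
    dispersion≡0 : D ≡ 0ℚ
    dispersion≡0 = begin
      D                   ≡⟨ *-identityˡ D ⟨
      1ℚ * D              ≡⟨ cong (_* D) (invPow*pow≡1 p m) ⟨
      p⁻ᵐ * pᵐ * D        ≡⟨ cong (_* D) (*-comm p⁻ᵐ pᵐ) ⟩
      pᵐ * p⁻ᵐ * D        ≡⟨ *-assoc pᵐ p⁻ᵐ D ⟩
      pᵐ * (p⁻ᵐ * D)      ≡⟨ cong (pᵐ *_) p⁻ᵐD≡0 ⟩
      pᵐ * 0ℚ             ≡⟨ *-zeroʳ pᵐ ⟩
      0ℚ                  ∎

open import Data.Integer using (+_)

proposition3p5 : (p n m : ℕ) .{{_ : NonZero p}} → Prime p →
  (F : 𝔽 p n → 𝔽 p m) →
  (N : ℚ) → imbalance F ≈ᶜ embed N →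
  ((β : 𝔽 p m) →
    ((+ preimageSize F β Data.Rational./ 1) - pow p n * invPow p m)
      * ((+ preimageSize F β Data.Rational./ 1) - pow p n * invPow p m)
      ≤ (1ℚ - invPow p m) * N)
  ×
  ((β : 𝔽 p m) →
    ((+ preimageSize F β Data.Rational./ 1) - pow p n * invPow p m)
      * ((+ preimageSize F β Data.Rational./ 1) - pow p n * invPow p m)
      ≡ (1ℚ - invPow p m) * N →
    (α : 𝔽 p m) → α ≢ β →
    (+ preimageSize F α Data.Rational./ 1) * (pow p m - 1ℚ)
      ≡ pow p n - (+ preimageSize F β Data.Rational./ 1))
proposition3p5 p n m p-prime F N imbalance≈N =
  (λ β → PreimageBound.preimage-bound p p-prime F N imbalance≈N β) ,
  (λ β → PreimageBound.preimage-equality p p-prime F N imbalance≈N β)
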